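{- The relation $\leadsto$ on acceleration problems preserves consistency, and the relation $\leadsto_e$ preserves exactness. That is: if $P$ is a consistent acceleration problem and $P \leadsto P'$, then $P'$ is consistent; and if $P$ is an exact acceleration problem and $P \leadsto_e P'$, then $P'$ is exact.
   Context: Fix $d \ge 1$, integer-valued variables $\vec{x}=(x_1,\dots,x_d)$, a variable $n$, and primed variables $\vec{x}'=(x_1',\dots,x_d')$; write $\vec{y}=(\vec{x},n,\vec{x}')$. Formulas are finite quantifier-free propositional formulas whose atoms have the form $p>0$ with $p$ a closed-form arithmetic expression (built from variables, integer constants, $+,-,\cdot,/$, exponentiation). Formulas are assumed to be in CNF and a CNF formula is identified with its set of clauses, so $\cup$ of formulas means conjunction and $\setminus$ means removal of clauses. A loop is a pair $\langle \phi,\vec{a}\rangle$ where $\phi$ is a formula over $\vec{x}$ and $\vec{a}:\mathbb{Z}^d\to\mathbb{Z}^d$ is given by closed-form expressions in $\vec{x}$; it induces the relation $\vec{x}\longrightarrow_{\langle\phi,\vec{a}\rangle}\vec{x}'$ iff $\phi(\vec{x})\land \vec{x}'=\vec{a}(\vec{x})$, and $\longrightarrow^n$ denotes its $n$-fold composition. A formula $\psi$ over $\vec{y}$ approximates $\langle\phi,\vec{a}\rangle$ if for all $n>0$ and $\vec{x},\vec{x}'\in\mathbb{Z}^d$, $\psi$ implies $\vec{x}\longrightarrow^n_{\langle\phi,\vec{a}\rangle}\vec{x}'$; it is equivalent to the loop if moreover the converse implication holds for all $n>0$. A conditional acceleration technique is a partial function $\mathit{accel}$ mapping pairs (loop $\langle\chi,\vec{a}\rangle$,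 formula $\check\phi$ over $\vec{x}$) to formulas over $\vec{y}$. It is sound if for every $(\langle\chi,\vec{a}\rangle,\check\phi)$ in its domain, all $\vec{x},\vec{x}'\in\mathbb{Z}^d$ and all $n>0$: $\vec{x}\longrightarrow^n_{\langle\check\phi,\vec{a}\rangle}\vec{x}'$ and $\mathit{accel}(\langle\chi,\vec{a}\rangle,\check\phi)$ together imply $\vec{x}\longrightarrow^n_{\langle\chi,\vec{a}\rangle}\vec{x}'$. It is exact if additionally $\vec{x}\longrightarrow^n_{\langle\chi\land\check\phi,\vec{a}\rangle}\vec{x}'$ implies $\mathit{accel}(\langle\chi,\vec{a}\rangle,\check\phi)$ for all such arguments. An acceleration problem is a tuple $\langle \psi \mid \check\phi \mid \hat\phi\rangle_{\vec{a}}$ with $\psi$ a formula over $\vec{y}$, $\check\phi,\hat\phi$ formulas over $\vec{x}$, and $\vec{a}:\mathbb{Z}^d\to\mathbb{Z}^d$. It is consistent if $\psi$ approximates $\langle\check\phi,\vec{a}\rangle$ and exact if $\psi$ is equivalent to $\langle\check\phi,\vec{a}\rangle$. The relation $\leadsto$ is defined by: $\langle \psi_1 \mid \check\phi \mid \hat\phi\rangle_{\vec{a}} \leadsto \langle \psi_1\cup\psi_2 \mid \check\phi\cup\chi \mid \hat\phi\setminus\chi\rangle_{\vec{a}}$ whenever $\emptyset\ne\chi\subseteq\hat\phi$ (a nonempty set of clauses of $\hat\phi$) and $\mathit{accel}(\langle\chi,\vec{a}\rangle,\check\phi)=\psi_2$ for some sound conditional acceleration technique $\mathit{accel}$. Such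 a step is written $\leadsto_e$ if $\mathit{accel}$ is exact. -}

module Defs where

open import Data.Bool using (Bool; true; false; _∧_; not)
open import Data.Nat as ℕ using (ℕ; zero; suc)
open import Data.Integer as ℤ using (ℤ; +_; -[1+_]; +[1+_])
open import Data.Rational as ℚ using (ℚ; mkℚ; 0ℚ; 1ℚ; _/_; 1/_)
open import Data.Fin using (Fin)
open import Data.Fin.Properties as FinP using ()
open import Data.Vec using (Vec; lookup)
open import Data.List using (List; []; _∷_; _++_)
open import Data.Bool.ListAction using (any)
open import Data.List.Relation.Unary.All using (All)
open import Data.List.Relation.Unary.Any using (Any)
open import Data.List.Membership.Propositional using (_∈_)
open import Data.Maybe using (Maybe; just)
open import Data.Product using (Σ; ∃; _×_)
open import Relation.Nullary using (¬_)
open import Relation.Nullary.Decidable using (⌊_⌋)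
open import Relation.Binary.PropositionalEquality using (_≡_; _≢_)

infixl 6 _⊕_ _⊖_
infixl 7 _⊗_ _⊘_
infixr 8 _⊛_

data Expr (V : Set) : Set where
  cst  : ℤ → Expr V
  var  : V → Expr V
  _⊕_ _⊖_ _⊗_ _⊘_ _⊛_ : Expr V → Expr V → Expr V

-- Convention (totalisation): division by 0 yields 0; q ^ e is the usual
-- power when e is an integer (negative exponents via reciprocals, with
-- 0 ^ (negative) = 0), and 0 when e is not an integer.

ℤ→ℚ : ℤ → ℚ
ℤ→ℚ z = z / 1

inv : ℚ → ℚ
inv (mkℚ (+ zero) d c)     = 0ℚ
inv (mkℚ +[1+ n ] d c)     = 1/ (mkℚ +[1+ n ] d c)
inv (mkℚ -[1+ n ] d c)     = 1/ (mkℚ -[1+ n ] d c)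

powℕ : ℚ → ℕ → ℚ
powℕ q zero    = 1ℚ
powℕ q (suc k) = q ℚ.* powℕ q k

pow : ℚ → ℚ → ℚ
pow q (mkℚ (+ k)     zero c)    = powℕ q k
pow q (mkℚ -[1+ k ]  zero c)    = inv (powℕ q (suc k))
pow q (mkℚ _         (suc _) c) = 0ℚ

⟦_⟧ₑ : ∀ {V} → Expr V → (V → ℤ) → ℚ
⟦ cst z ⟧ₑ ρ = ℤ→ℚ z
⟦ var v ⟧ₑ ρ = ℤ→ℚ (ρ v)
⟦ e ⊕ f ⟧ₑ ρ = ⟦ e ⟧ₑ ρ ℚ.+ ⟦ f ⟧ₑ ρ
⟦ e ⊖ f ⟧ₑ ρ = ⟦ e ⟧ₑ ρ ℚ.- ⟦ f ⟧ₑ ρ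
⟦ e ⊗ f ⟧ₑ ρ = ⟦ e ⟧ₑ ρ ℚ.* ⟦ f ⟧ₑ ρ
⟦ e ⊘ f ⟧ₑ ρ = ⟦ e ⟧ₑ ρ ℚ.* inv (⟦ f ⟧ₑ ρ)
⟦ e ⊛ f ⟧ₑ ρ = pow (⟦ e ⟧ₑ ρ) (⟦ f ⟧ₑ ρ)

-- CNF formulas: an atom is "p > 0", a clause is a disjunction (list) of
-- atoms, a formula is a conjunction (list) of clauses.  A CNF formula is
-- identified with its set of clauses: ∪ is _++_, ⊆ is membership of every
-- clause, ∖ removes clauses.

Atom : Set → Set
Atom V = Expr V

Clause : Set → Set
Clause V = List (Atom V)

Formula : Set → Set
Formula V = List (Clause V)

⟦_⟧ : ∀ {V} → Formula V → (V → ℤ) → Set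
⟦ φ ⟧ ρ = All (λ c → Any (λ p → 0ℚ ℚ.< ⟦ p ⟧ₑ ρ) c) φ

_⊆ᶠ_ : ∀ {V} → Formula V → Formula V → Set
χ ⊆ᶠ φ = All (_∈ φ) χ

module _ {V : Set} (eqV : V → V → Bool) where
  eqE : Expr V → Expr V → Bool
  eqE (cst a) (cst b) = ⌊ a ℤ.≟ b ⌋
  eqE (var u) (var v) = eqV u v
  eqE (e ⊕ f) (e' ⊕ f') = eqE e e' ∧ eqE f f'
  eqE (e ⊖ f) (e' ⊖ f') = eqE e e' ∧ eqE f f'
  eqE (e ⊗ f) (e' ⊗ f') = eqE e e' ∧ eqE f f'
  eqE (e ⊘ f) (e' ⊘ f') = eqE e e' ∧ eqE f f'
  eqE (e ⊛ f) (e' ⊛ f') = eqE e e' ∧ eqE f f'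
  eqE _ _ = false

  eqC : Clause V → Clause V → Bool
  eqC []       []       = true
  eqC (p ∷ c)  (q ∷ c') = eqE p q ∧ eqC c c'
  eqC _        _        = false

  removeClauses : Formula V → Formula V → Formula V
  removeClauses φ χ = Data.List.filterᵇ (λ c → not (any (eqC c) χ)) φ

_∖_ : ∀ {d} → Formula (Fin d) → Formula (Fin d) → Formula (Fin d)
φ ∖ χ = removeClauses (λ i j → ⌊ i FinP.≟ j ⌋) φ χ

data YVar (d : ℕ) : Set where
  xv  : Fin d → YVar d
  nv  : YVar d
  xv′ : Fin d → YVar d

yval : ∀ {d} → Vec ℤ d → ℕ → Vec ℤ d → YVar d → ℤ
yval x n x′ (xv i)  = lookup x i
yval x n x′ nv      = + n
yval x n x′ (xv′ i) = lookup x′ i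

Update : ℕ → Set
Update d = Fin d → Expr (Fin d)

IntValued : ∀ {d} → Update d → Set
IntValued {d} a = ∀ (x : Vec ℤ d) (i : Fin d) → ∃ λ z → ⟦ a i ⟧ₑ (lookup x) ≡ ℤ→ℚ z

Step : ∀ {d} → Formula (Fin d) → Update d → Vec ℤ d → Vec ℤ d → Set
Step {d} φ a x x′ = ⟦ φ ⟧ (lookup x) × (∀ (i : Fin d) → ⟦ a i ⟧ₑ (lookup x) ≡ ℤ→ℚ (lookup x′ i))

data Iter {d} (φ : Formula (Fin d)) (a : Update d) : ℕ → Vec ℤ d → Vec ℤ d → Set where
  iter-zero : ∀ {x} → Iter φ a zero x x
  iter-suc  : ∀ {n x x′ x″} → Step φ a x x′ → Iter φ a n x′ x″ → Iter φ a (suc n) x x″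

Approximates : ∀ {d} → Formula (YVar d) → Formula (Fin d) → Update d → Set
Approximates {d} ψ φ a =
  ∀ (n : ℕ) → 0 ℕ.< n → ∀ (x x′ : Vec ℤ d) → ⟦ ψ ⟧ (yval x n x′) → Iter φ a n x x′

Equivalent : ∀ {d} → Formula (YVar d) → Formula (Fin d) → Update d → Set
Equivalent {d} ψ φ a =
  Approximates ψ φ a ×
  (∀ (n : ℕ) → 0 ℕ.< n → ∀ (x x′ : Vec ℤ d) → Iter φ a n x x′ → ⟦ ψ ⟧ (yval x n x′))

Accel : ℕ → Set
Accel d = Formula (Fin d) → Update d → Formula (Fin d) → Maybe (Formula (YVar d))

Sound : ∀ {d} → Accel d → Set
Sound {d} accel =
  ∀ (χ : Formula (Fin d)) (a : Update d) (φ̌ : Formula (Fin d)) (ψ : Formula (YVar d)) →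
  IntValued a → accel χ a φ̌ ≡ just ψ →
  ∀ (n : ℕ) → 0 ℕ.< n → ∀ (x x′ : Vec ℤ d) →
  Iter φ̌ a n x x′ → ⟦ ψ ⟧ (yval x n x′) → Iter χ a n x x′

ExactAccel : ∀ {d} → Accel d → Set
ExactAccel {d} accel =
  Sound accel ×
  (∀ (χ : Formula (Fin d)) (a : Update d) (φ̌ : Formula (Fin d)) (ψ : Formula (YVar d)) →
   IntValued a → accel χ a φ̌ ≡ just ψ →
   ∀ (n : ℕ) → 0 ℕ.< n → ∀ (x x′ : Vec ℤ d) →
   Iter (χ ++ φ̌) a n x x′ → ⟦ ψ ⟧ (yval x n x′))

record Problem (d : ℕ) : Set where
  constructor ⟨_∣_∣_⟩_
  field
    ψ  : Formula (YVar d)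
    φ̌  : Formula (Fin d)
    φ̂  : Formula (Fin d)
    a  : Update d

Consistent : ∀ {d} → Problem d → Set
Consistent P = Approximates (Problem.ψ P) (Problem.φ̌ P) (Problem.a P)

ExactProblem : ∀ {d} → Problem d → Set
ExactProblem P = Equivalent (Problem.ψ P) (Problem.φ̌ P) (Problem.a P)

data Leads {d} (Q : Accel d → Set) : Problem d → Problem d → Set where
  leads : ∀ {ψ₁ φ̌ φ̂ a} (χ : Formula (Fin d)) (ψ₂ : Formula (YVar d)) (accel : Accel d) →
          χ ≢ [] → χ ⊆ᶠ φ̂ → Q accel → accel χ a φ̌ ≡ just ψ₂ →
          Leads Q (⟨ ψ₁ ∣ φ̌ ∣ φ̂ ⟩ a) (⟨ ψ₁ ++ ψ₂ ∣ φ̌ ++ χ ∣ φ̂ ∖ χ ⟩ a)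

_⇝_ : ∀ {d} → Problem d → Problem d → Set
_⇝_ = Leads Sound

_⇝ₑ_ : ∀ {d} → Problem d → Problem d → Set
_⇝ₑ_ = Leads ExactAccel

module Submission where

-- Since the update a⃗ is deterministic, two n-step runs of ⟨φ,a⃗⟩ and ⟨φ′,a⃗⟩ from the
-- same start to the same end visit the same states, so they combine into a run of
-- ⟨φ ∪ φ′,a⃗⟩.  For ⇝: ψ₁ yields a ⟨φ̌,a⃗⟩-run, soundness of accel turns it together
-- with ψ₂ into a ⟨χ,a⃗⟩-run, and the two combine into a ⟨φ̌ ∪ χ,a⃗⟩-run.  For ⇝ₑ the
-- converse direction is immediate: a ⟨φ̌ ∪ χ,a⃗⟩-run is both a ⟨φ̌,a⃗⟩-run, giving ψ₁
-- by exactness of the problem, and a ⟨χ ∪ φ̌,a⃗⟩-run, giving ψ₂ by exactness of accel.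

open import Defs
open import Data.Nat using (ℕ; _≤_)
open import Data.Product using (_×_; _,_; proj₁; proj₂)
open import Data.Integer using (ℤ)
import Data.Integer.Properties as ℤ
import Data.Rational.Properties as ℚ
open import Data.Rational.Unnormalised using (mkℚᵘ; *≡*)
open import Data.Fin using (Fin)
open import Data.Vec using (Vec; lookup)
open import Data.Vec.Properties using (tabulate∘lookup; tabulate-cong)
open import Data.List using (_++_)
open import Data.List.Relation.Unary.All.Properties using (++⁺; ++⁻ˡ; ++⁻ʳ)
open import Relation.Binary.PropositionalEquality

ℤ→ℚ-injective : ∀ {z w} → ℤ→ℚ z ≡ ℤ→ℚ w → z ≡ w
ℤ→ℚ-injective {z} {w} eq with ℚ./-injective-≃ (mkℚᵘ z 0) (mkℚᵘ w 0) eq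
... | *≡* z*1≡w*1 = trans (sym (ℤ.*-identityʳ z)) (trans z*1≡w*1 (ℤ.*-identityʳ w))

lookup-extensionality : ∀ {d} {x y : Vec ℤ d} → (∀ i → lookup x i ≡ lookup y i) → x ≡ y
lookup-extensionality {x = x} {y} eq =
  trans (sym (tabulate∘lookup x)) (trans (tabulate-cong eq) (tabulate∘lookup y))

module _ {d : ℕ} {a : Update d} where

  Step-deterministic : ∀ {φ φ′ x y y′} → Step φ a x y → Step φ′ a x y′ → y ≡ y′
  Step-deterministic (_ , ay) (_ , ay′) =
    lookup-extensionality (λ i → ℤ→ℚ-injective (trans (sym (ay i)) (ay′ i)))

  Iter-map : ∀ {φ φ′ n x y} → (∀ {ρ} → ⟦ φ ⟧ ρ → ⟦ φ′ ⟧ ρ) → Iter φ a n x y → Iter φ′ a n x y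
  Iter-map f iter-zero               = iter-zero
  Iter-map f (iter-suc (φx , ax) r) = iter-suc (f φx , ax) (Iter-map f r)

  Iter-++⁺ : ∀ {φ φ′ n x y} → Iter φ a n x y → Iter φ′ a n x y → Iter (φ ++ φ′) a n x y
  Iter-++⁺ iter-zero iter-zero = iter-zero
  Iter-++⁺ {φ} {φ′} {x = x} (iter-suc {x′ = z} s r) (iter-suc {x′ = z′} s′ r′)
    with refl ← Step-deterministic {φ} {φ′} {x} {z} {z′} s s′ =
    iter-suc (++⁺ (proj₁ s) (proj₁ s′) , proj₂ s) (Iter-++⁺ r r′)

  Iter-++⁻ˡ : ∀ φ {φ′ n x y} → Iter (φ ++ φ′) a n x y → Iter φ a n x y
  Iter-++⁻ˡ φ = Iter-map (++⁻ˡ φ)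

  Iter-++-comm : ∀ φ {φ′ n x y} → Iter (φ ++ φ′) a n x y → Iter (φ′ ++ φ) a n x y
  Iter-++-comm φ = Iter-map (λ h → ++⁺ (++⁻ʳ φ h) (++⁻ˡ φ h))

module _ {d : ℕ} where

  Leads-preserves-Consistent : ∀ {Q : Accel d → Set} → (∀ {accel} → Q accel → Sound accel) →
    ∀ {P P′ : Problem d} →
    IntValued (Problem.a P) → Consistent P → Leads Q P P′ → Consistent P′
  Leads-preserves-Consistent Q⇒Sound intValued consistent
    (leads {ψ₁} χ ψ₂ accel _ _ q accel≡ψ₂) n n>0 x x′ ψ₁∪ψ₂ =
    Iter-++⁺ run (Q⇒Sound q χ _ _ ψ₂ intValued accel≡ψ₂ n n>0 x x′ run (++⁻ʳ ψ₁ ψ₁∪ψ₂))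
    where run = consistent n n>0 x x′ (++⁻ˡ ψ₁ ψ₁∪ψ₂)

  ⇝-preserves-Consistent : ∀ {P P′ : Problem d} →
    IntValued (Problem.a P) → Consistent P → P ⇝ P′ → Consistent P′
  ⇝-preserves-Consistent = Leads-preserves-Consistent (λ sound → sound)

  ⇝ₑ-preserves-ExactProblem : ∀ {P P′ : Problem d} →
    IntValued (Problem.a P) → ExactProblem P → P ⇝ₑ P′ → ExactProblem P′
  ⇝ₑ-preserves-ExactProblem intValued (approximates , complete)
    step@(leads {φ̌ = φ̌} χ ψ₂ _ _ _ (_ , accelComplete) accel≡ψ₂) =
    Leads-preserves-Consistent proj₁ intValued approximates step ,
    λ n n>0 x x′ run →
      ++⁺ (complete n n>0 x x′ (Iter-++⁻ˡ φ̌ run))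
          (accelComplete χ _ _ ψ₂ intValued accel≡ψ₂ n n>0 x x′ (Iter-++-comm φ̌ run))

lemma1 : (d : ℕ) → 1 ≤ d →
    (∀ (P P′ : Problem d) → IntValued (Problem.a P) → Consistent P → P ⇝ P′ → Consistent P′) ×
    (∀ (P P′ : Problem d) → IntValued (Problem.a P) → ExactProblem P → P ⇝ₑ P′ → ExactProblem P′)
lemma1 d _ =
  (λ _ _ → ⇝-preserves-Consistent) ,
  (λ _ _ → ⇝ₑ-preserves-ExactProblem)
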